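{- Let $G$ be a finite abelian group and let $A, B$ be nonempty subsets of $G$ with $|A| \geq |B|$, $|A+B|<\frac{3}{2}|A|$ and $|B|>\frac{3}{4}|A|$. Then there is a subgroup $H$ of $G$ with $|H|<\frac{3}{2}|A|$ such that $A+B$ lies in a single coset of $H$.
   Context: $A+B=\{a+b : a\in A, b\in B\}$. -}

module Defs where

open import Level using (0ℓ)
open import Data.Bool using (Bool; true; false; _∧_)
open import Data.Nat using (ℕ)
open import Data.List using (List; length; filterᵇ)
open import Data.Bool.ListAction using (any)
open import Data.List.Membership.Propositional using (_∈_)
open import Data.List.Relation.Unary.Unique.Propositional using (Unique)
open import Data.Product using (Σ; ∃; _×_; _,_)
open import Relation.Binary.PropositionalEquality using (_≡_)
open import Relation.Binary.Definitions using (DecidableEquality)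
open import Relation.Nullary.Decidable using (⌊_⌋)
open import Algebra.Structures using (IsAbelianGroup)

record FiniteAbelianGroup : Set₁ where
  field
    Carrier  : Set
    _∙_      : Carrier → Carrier → Carrier
    ε        : Carrier
    _⁻¹      : Carrier → Carrier
    isAbelianGroup : IsAbelianGroup _≡_ _∙_ ε _⁻¹
    _≟_      : DecidableEquality Carrier
    elements : List Carrier
    unique   : Unique elements
    complete : (x : Carrier) → x ∈ elements

module _ (G : FiniteAbelianGroup) where
  open FiniteAbelianGroup G

  Subset : Set
  Subset = Carrier → Bool

  _∈ₛ_ : Carrier → Subset → Set
  x ∈ₛ S = S x ≡ true

  card : Subset → ℕ
  card S = length (filterᵇ S elements)

  Nonempty : Subset → Set
  Nonempty S = Σ Carrier (λ x → x ∈ₛ S)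

  sumset : Subset → Subset → Subset
  sumset A B x = any (λ a → any (λ b → A a ∧ (B b ∧ ⌊ x ≟ (a ∙ b) ⌋)) elements) elements

  record IsSubgroup (H : Subset) : Set where
    field
      ε∈H  : ε ∈ₛ H
      ∙∈H  : ∀ x y → x ∈ₛ H → y ∈ₛ H → (x ∙ y) ∈ₛ H
      ⁻¹∈H : ∀ x → x ∈ₛ H → (x ⁻¹) ∈ₛ H

  InSingleCoset : Subset → Subset → Set
  InSingleCoset S H = Σ Carrier (λ g → ∀ x → x ∈ₛ S → Σ Carrier (λ h → h ∈ₛ H × x ≡ g ∙ h))

module Submission where

-- Write S = A + B, a = |A|, b = |B|, s = |S|, so 2s < 3a < 4b and b ≤ a.
-- The subgroup is the difference set H = B - B.  The proof runs as follows.
--   1. A - A ⊆ H: two translates x + B, y + B (x, y ∈ A) lie in S and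
--      |S| < 2b, so they meet, and x - y is then a difference in B.
--   2. For h = y₁ - y₂ ∈ H the translates A + y₁, A + y₂ lie in S, so
--      Q h = A ∩ (A - h) has at least 2a - s elements.
--   3. H is a subgroup: for h, k ∈ H the sets Q h, Q (-k) ⊆ A have more
--      than 4a - 2s > a elements in total, so they share some w, and
--      h + k = (w + h) - (w - k) ∈ A - A ⊆ H.
--   4. The representation counts r(c) = |A ∩ (c - B)| vanish off S and sum
--      to ab > s(s - a) (double counting), so some c has r(c) > s - a.
--   5. For such c, A ∩ (c - B) meets Q h for every h ∈ H, so c + H ⊆ S
--      and |H| ≤ s < 3a/2.
--   6. S - S ⊆ (A - A) + (B - B) ⊆ H, so S lies in the coset c + H.

open import Defs
open import Level using (0ℓ)
open import Algebra.Bundles using (AbelianGroup; Group)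
open import Data.Bool using (Bool; true; false; _∧_; _∨_; T?)
open import Data.Bool.Properties using (T-≡)
open import Data.Bool.ListAction using (any)
open import Data.Nat using (ℕ; zero; suc; _+_; _*_; _∸_; _≤_; _<_; _≥_; z≤n; z<s; >-nonZero)
open import Data.Nat.Properties hiding (_≟_)
open import Data.Nat.ListAction using (sum)
open import Data.Nat.Tactic.RingSolver using (solve-∀)
open import Data.List using (List; []; _∷_; length; filterᵇ; filter; map)
open import Data.List.Properties using (map-cong; length-map; filter-notAll)
open import Data.List.Membership.Propositional using (_∈_; find; lose)
open import Data.List.Membership.Propositional.Properties using (∈-filter⁺; ∈-filter⁻; ∈-map⁻)
open import Data.List.Relation.Unary.All as All using ()
open import Data.List.Relation.Unary.Any using (here; there)
open import Data.List.Relation.Unary.Any.Properties using (any⁺; any⁻)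
open import Data.List.Relation.Unary.AllPairs using (_∷_)
open import Data.List.Relation.Unary.Unique.Propositional using (Unique)
import Data.List.Relation.Unary.Unique.Propositional.Properties as Unique
open import Data.Product using (Σ; _×_; _,_; proj₁; proj₂)
open import Function using (Equivalence)
open import Relation.Binary.Definitions using (DecidableEquality)
open import Relation.Binary.PropositionalEquality
open import Relation.Nullary using (yes; no; ¬?; contradiction)
open import Relation.Nullary.Decidable using (toWitness; fromWitness)
open import Algebra.Properties.CommutativeSemigroup +-commutativeSemigroup
  using () renaming (interchange to +-interchange)

indicator : Bool → ℕ
indicator true  = 1
indicator false = 0

∧-true : ∀ {x y} → x ≡ true → y ≡ true → x ∧ y ≡ true
∧-true refl refl = refl

∧-true⁻ : ∀ x {y} → x ∧ y ≡ true → x ≡ true × y ≡ true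
∧-true⁻ true y≡true = refl , y≡true

-- Counting elements of a list that satisfy a boolean predicate

module Counting {C : Set} where

  count : (C → Bool) → List C → ℕ
  count p l = length (filterᵇ p l)

  count-∷ : ∀ p x l → count p (x ∷ l) ≡ indicator (p x) + count p l
  count-∷ p x l with p x
  ... | true  = refl
  ... | false = refl

  count-cong : ∀ p q l → (∀ x → p x ≡ q x) → count p l ≡ count q l
  count-cong p q []      p≗q = refl
  count-cong p q (x ∷ l) p≗q = begin
    count p (x ∷ l)               ≡⟨ count-∷ p x l ⟩
    indicator (p x) + count p l   ≡⟨ cong₂ _+_ (cong indicator (p≗q x)) (count-cong p q l p≗q) ⟩
    indicator (q x) + count q l   ≡⟨ count-∷ q x l ⟨
    count q (x ∷ l)               ∎
    where open ≡-Reasoning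

  count-false : ∀ l → count (λ _ → false) l ≡ 0
  count-false []      = refl
  count-false (x ∷ l) = count-false l

  count-mono : ∀ p q l → (∀ x → p x ≡ true → q x ≡ true) → count p l ≤ count q l
  count-mono p q []      p⇒q = z≤n
  count-mono p q (x ∷ l) p⇒q = begin
    count p (x ∷ l)               ≡⟨ count-∷ p x l ⟩
    indicator (p x) + count p l   ≤⟨ +-mono-≤ (indicator-mono (p x) (q x) (p⇒q x))
                                              (count-mono p q l p⇒q) ⟩
    indicator (q x) + count q l   ≡⟨ count-∷ q x l ⟨
    count q (x ∷ l)               ∎
    where
    open ≤-Reasoning
    indicator-mono : ∀ u v → (u ≡ true → v ≡ true) → indicator u ≤ indicator v
    indicator-mono false v u⇒v = z≤n
    indicator-mono true  v u⇒v rewrite u⇒v refl = ≤-refl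

  count-∨-∧ : ∀ p q l →
    count (λ x → p x ∨ q x) l + count (λ x → p x ∧ q x) l ≡ count p l + count q l
  count-∨-∧ p q []      = refl
  count-∨-∧ p q (x ∷ l) = begin
    count p∨q (x ∷ l) + count p∧q (x ∷ l)
      ≡⟨ cong₂ _+_ (count-∷ p∨q x l) (count-∷ p∧q x l) ⟩
    (indicator (p∨q x) + count p∨q l) + (indicator (p∧q x) + count p∧q l)
      ≡⟨ +-interchange (indicator (p∨q x)) (count p∨q l) (indicator (p∧q x)) (count p∧q l) ⟩
    (indicator (p∨q x) + indicator (p∧q x)) + (count p∨q l + count p∧q l)
      ≡⟨ cong₂ _+_ (indicator-∨-∧ (p x) (q x)) (count-∨-∧ p q l) ⟩
    (indicator (p x) + indicator (q x)) + (count p l + count q l)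
      ≡⟨ +-interchange (indicator (p x)) (indicator (q x)) (count p l) (count q l) ⟩
    (indicator (p x) + count p l) + (indicator (q x) + count q l)
      ≡⟨ cong₂ _+_ (count-∷ p x l) (count-∷ q x l) ⟨
    count p (x ∷ l) + count q (x ∷ l) ∎
    where
    open ≡-Reasoning
    p∨q p∧q : C → Bool
    p∨q y = p y ∨ q y
    p∧q y = p y ∧ q y
    indicator-∨-∧ : ∀ u v → indicator (u ∨ v) + indicator (u ∧ v) ≡ indicator u + indicator v
    indicator-∨-∧ true  true  = refl
    indicator-∨-∧ true  false = refl
    indicator-∨-∧ false true  = refl
    indicator-∨-∧ false false = refl

  count-witness : ∀ p l → 0 < count p l → Σ C (λ x → p x ≡ true)
  count-witness p (x ∷ l) pos with p x in px
  ... | true  = x , px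
  ... | false = count-witness p l pos

  count≡sum : ∀ p l → count p l ≡ sum (map (λ x → indicator (p x)) l)
  count≡sum p []      = refl
  count≡sum p (x ∷ l) = trans (count-∷ p x l) (cong (indicator (p x) +_) (count≡sum p l))

  sum-zero : ∀ l → sum (map (λ (_ : C) → 0) l) ≡ 0
  sum-zero []      = refl
  sum-zero (x ∷ l) = sum-zero l

  sum-+ : ∀ (f g : C → ℕ) l → sum (map (λ x → f x + g x) l) ≡ sum (map f l) + sum (map g l)
  sum-+ f g []      = refl
  sum-+ f g (x ∷ l) = begin
    (f x + g x) + sum (map (λ y → f y + g y) l)   ≡⟨ cong ((f x + g x) +_) (sum-+ f g l) ⟩
    (f x + g x) + (sum (map f l) + sum (map g l)) ≡⟨ +-interchange (f x) (g x) (sum (map f l)) (sum (map g l)) ⟩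
    (f x + sum (map f l)) + (g x + sum (map g l)) ∎
    where open ≡-Reasoning

  sum-*ʳ : ∀ (f : C → ℕ) k l → sum (map (λ x → f x * k) l) ≡ sum (map f l) * k
  sum-*ʳ f k []      = refl
  sum-*ʳ f k (x ∷ l) =
    trans (cong (f x * k +_) (sum-*ʳ f k l)) (sym (*-distribʳ-+ k (f x) (sum (map f l))))

  above-average : ∀ (f : C → ℕ) S m l → (∀ x → S x ≡ false → f x ≡ 0) →
    count S l * m < sum (map f l) → Σ C (λ x → m < f x)
  above-average f S m (x ∷ l) off-S large with m <? f x
  ... | yes m<fx = x , m<fx
  ... | no  m≮fx = above-average f S m l off-S (+-cancelˡ-< (indicator (S x) * m) _ _ (begin-strict
    indicator (S x) * m + count S l * m  ≡⟨ *-distribʳ-+ m (indicator (S x)) (count S l) ⟨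
    (indicator (S x) + count S l) * m    ≡⟨ cong (_* m) (count-∷ S x l) ⟨
    count S (x ∷ l) * m                  <⟨ large ⟩
    f x + sum (map f l)                  ≤⟨ +-monoˡ-≤ (sum (map f l)) fx≤ ⟩
    indicator (S x) * m + sum (map f l)  ∎))
    where
    open ≤-Reasoning
    fx≤ : f x ≤ indicator (S x) * m
    fx≤ with S x in Sx
    ... | true  = subst (f x ≤_) (sym (+-identityʳ m)) (≮⇒≥ m≮fx)
    ... | false = ≤-reflexive (off-S x Sx)

  unique-⊆-length : DecidableEquality C → ∀ xs ys → Unique xs →
    (∀ {z} → z ∈ xs → z ∈ ys) → length xs ≤ length ys
  unique-⊆-length _≟_ []       ys _            xs⊆ys = z≤n
  unique-⊆-length _≟_ (x ∷ xs) ys (x∉xs ∷ uxs) xs⊆ys =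
    ≤-<-trans (unique-⊆-length _≟_ xs ys′ uxs xs⊆ys′) ys′<ys
    where
    ys′ : List C
    ys′ = filter (λ y → ¬? (y ≟ x)) ys
    xs⊆ys′ : ∀ {z} → z ∈ xs → z ∈ ys′
    xs⊆ys′ z∈xs = ∈-filter⁺ (λ y → ¬? (y ≟ x)) (xs⊆ys (there z∈xs))
                    (λ z≡x → All.lookup x∉xs z∈xs (sym z≡x))
    ys′<ys : length ys′ < length ys
    ys′<ys = filter-notAll (λ y → ¬? (y ≟ x)) ys (lose (xs⊆ys (here refl)) (λ ¬x≡x → ¬x≡x refl))

open Counting

double-count : ∀ {C D : Set} (P : C → D → Bool) xs ys →
  sum (map (λ x → count (P x) ys) xs) ≡ sum (map (λ y → count (λ x → P x y) xs) ys)
double-count P xs []       = sum-zero xs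
double-count P xs (y ∷ ys) = begin
  sum (map (λ x → count (P x) (y ∷ ys)) xs)
    ≡⟨ cong sum (map-cong (λ x → count-∷ (P x) y ys) xs) ⟩
  sum (map (λ x → indicator (P x y) + count (P x) ys) xs)
    ≡⟨ sum-+ (λ x → indicator (P x y)) (λ x → count (P x) ys) xs ⟩
  sum (map (λ x → indicator (P x y)) xs) + sum (map (λ x → count (P x) ys) xs)
    ≡⟨ cong₂ _+_ (sym (count≡sum (λ x → P x y) xs)) (double-count P xs ys) ⟩
  count (λ x → P x y) xs + sum (map (λ y′ → count (λ x → P x y′) xs) ys) ∎
  where open ≡-Reasoning

any-true⁺ : ∀ {C : Set} (p : C → Bool) {x} l → x ∈ l → p x ≡ true → any p l ≡ true
any-true⁺ p l x∈l px = Equivalence.to T-≡ (any⁺ p (lose x∈l (Equivalence.from T-≡ px)))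

any-true⁻ : ∀ {C : Set} (p : C → Bool) l → any p l ≡ true → Σ C (λ x → p x ≡ true)
any-true⁻ p l anyp =
  let x , _ , px = find (any⁻ p l (Equivalence.from T-≡ anyp)) in x , Equivalence.to T-≡ px

-- Subsets of a finite abelian group

module FiniteGroup (G : FiniteAbelianGroup) where

  open FiniteAbelianGroup G using (Carrier; isAbelianGroup; _≟_; elements; unique; complete)

  abelianGroup : AbelianGroup 0ℓ 0ℓ
  abelianGroup = record { isAbelianGroup = isAbelianGroup }

  open AbelianGroup abelianGroup public using (_∙_; ε; _⁻¹; assoc; comm; identityˡ; identityʳ; inverseʳ)
  open Group (AbelianGroup.group abelianGroup) public using (_//_)
  open import Algebra.Properties.AbelianGroup abelianGroup public
    using (⁻¹-anti-homo-//; ⁻¹-∙-comm; ⁻¹-involutive; //-rightDividesˡ; //-rightDividesʳ)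
  open import Algebra.Properties.CommutativeSemigroup (AbelianGroup.commutativeSemigroup abelianGroup)
    using (interchange)

  -- Identities for the difference x // y = x ∙ y ⁻¹, written x - y in the comments.
  module _ where
    open ≡-Reasoning

    add-sub-cancel : ∀ g z → g ∙ (z // g) ≡ z
    add-sub-cancel g z = trans (comm g (z // g)) (//-rightDividesˡ g z)

    sub-interchange : ∀ x y u v → (x ∙ y) // (u ∙ v) ≡ (x // u) ∙ (y // v)
    sub-interchange x y u v = begin
      (x ∙ y) ∙ (u ∙ v) ⁻¹       ≡⟨ cong ((x ∙ y) ∙_) (⁻¹-∙-comm u v) ⟨
      (x ∙ y) ∙ (u ⁻¹ ∙ v ⁻¹)    ≡⟨ interchange x y (u ⁻¹) (v ⁻¹) ⟩
      (x ∙ u ⁻¹) ∙ (y ∙ v ⁻¹)    ∎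

    sub-cancelˡ : ∀ w x y → (w ∙ x) // (w ∙ y) ≡ x // y
    sub-cancelˡ w x y = begin
      (w ∙ x) // (w ∙ y)         ≡⟨ sub-interchange w x w y ⟩
      (w // w) ∙ (x // y)        ≡⟨ cong (_∙ (x // y)) (inverseʳ w) ⟩
      ε ∙ (x // y)               ≡⟨ identityˡ (x // y) ⟩
      x // y                     ∎

    sub-of-subs : ∀ z x y → (z // y) // (z // x) ≡ x // y
    sub-of-subs z x y = begin
      (z ∙ y ⁻¹) // (z ∙ x ⁻¹)   ≡⟨ sub-cancelˡ z (y ⁻¹) (x ⁻¹) ⟩
      y ⁻¹ ∙ x ⁻¹ ⁻¹             ≡⟨ cong (y ⁻¹ ∙_) (⁻¹-involutive x) ⟩
      y ⁻¹ ∙ x                   ≡⟨ comm (y ⁻¹) x ⟩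
      x // y                     ∎

    sub-add-sub : ∀ z x y → (z // x) ∙ (x // y) ≡ z // y
    sub-add-sub z x y = trans (sym (assoc (z // x) x (y ⁻¹))) (cong (_// y) (//-rightDividesˡ x z))

    product-as-difference : ∀ w h k → (w ∙ h) // (w ∙ k ⁻¹) ≡ h ∙ k
    product-as-difference w h k = trans (sub-cancelˡ w h (k ⁻¹)) (cong (h ∙_) (⁻¹-involutive k))

    translate-split : ∀ c u h → (u ∙ h) ∙ (c // u) ≡ c ∙ h
    translate-split c u h = begin
      (u ∙ h) ∙ (c // u)         ≡⟨ cong (_∙ (c // u)) (comm u h) ⟩
      (h ∙ u) ∙ (c // u)         ≡⟨ assoc h u (c // u) ⟩
      h ∙ (u ∙ (c // u))         ≡⟨ cong (h ∙_) (add-sub-cancel u c) ⟩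
      h ∙ c                      ≡⟨ comm h c ⟩
      c ∙ h                      ∎

  ∣_∣ : Subset G → ℕ
  ∣ X ∣ = card G X

  _⊆_ : Subset G → Subset G → Set
  X ⊆ Y = ∀ x → X x ≡ true → Y x ≡ true

  _∩_ : Subset G → Subset G → Subset G
  (X ∩ Y) x = X x ∧ Y x

  _+ₛ_ : Subset G → Carrier → Subset G
  (X +ₛ g) z = X (z // g)

  differences : Subset G → Subset G
  differences X = sumset G X (λ y → X (y ⁻¹))

  card-injective : ∀ X Y (f : Carrier → Carrier) → (∀ {x y} → f x ≡ f y → x ≡ y) →
    (∀ x → X x ≡ true → Y (f x) ≡ true) → ∣ X ∣ ≤ ∣ Y ∣
  card-injective X Y f f-inj X→Y = subst (_≤ ∣ Y ∣) (length-map f Xs)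
    (unique-⊆-length _≟_ (map f Xs) (filterᵇ Y elements)
      (Unique.map⁺ f-inj (Unique.filter⁺ (λ x → T? (X x)) unique)) image⊆Y)
    where
    Xs : List Carrier
    Xs = filterᵇ X elements
    image⊆Y : ∀ {z} → z ∈ map f Xs → z ∈ filterᵇ Y elements
    image⊆Y z∈fXs with ∈-map⁻ f z∈fXs
    ... | x , x∈Xs , refl = ∈-filter⁺ (λ y → T? (Y y)) (complete (f x))
      (Equivalence.from T-≡ (X→Y x (Equivalence.to T-≡
        (proj₂ (∈-filter⁻ (λ y → T? (X y)) {xs = elements} x∈Xs)))))

  card-translate : ∀ X g → ∣ X +ₛ g ∣ ≡ ∣ X ∣
  card-translate X g = ≤-antisym
    (card-injective (X +ₛ g) X (_// g) (cancel (g ⁻¹)) (λ x X[x//g] → X[x//g]))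
    (card-injective X (X +ₛ g) (_∙ g) (cancel g)
      (λ x Xx → subst (λ t → X t ≡ true) (sym (//-rightDividesʳ g x)) Xx))
    where
    cancel : ∀ u {x y} → x ∙ u ≡ y ∙ u → x ≡ y
    cancel u {x} {y} e = begin
      x                ≡⟨ //-rightDividesʳ u x ⟨
      (x ∙ u) // u     ≡⟨ cong (_// u) e ⟩
      (y ∙ u) // u     ≡⟨ //-rightDividesʳ u y ⟩
      y                ∎
      where open ≡-Reasoning

  card-overlap : ∀ X Y Z → X ⊆ Z → Y ⊆ Z → ∣ X ∣ + ∣ Y ∣ ≤ ∣ X ∩ Y ∣ + ∣ Z ∣
  card-overlap X Y Z X⊆Z Y⊆Z = begin
    ∣ X ∣ + ∣ Y ∣                                    ≡⟨ count-∨-∧ X Y elements ⟨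
    count (λ x → X x ∨ Y x) elements + ∣ X ∩ Y ∣    ≡⟨ +-comm _ (∣ X ∩ Y ∣) ⟩
    ∣ X ∩ Y ∣ + count (λ x → X x ∨ Y x) elements    ≤⟨ +-monoʳ-≤ (∣ X ∩ Y ∣)
                                                          (count-mono _ Z elements X∪Y⊆Z) ⟩
    ∣ X ∩ Y ∣ + ∣ Z ∣                                ∎
    where
    open ≤-Reasoning
    X∪Y⊆Z : ∀ x → (X x ∨ Y x) ≡ true → Z x ≡ true
    X∪Y⊆Z x X∨Y with X x in Xx
    ... | true  = X⊆Z x Xx
    ... | false = Y⊆Z x X∨Y

  overlap-nonempty : ∀ X Y Z → X ⊆ Z → Y ⊆ Z → ∣ Z ∣ < ∣ X ∣ + ∣ Y ∣ →
    Σ Carrier (λ z → X z ≡ true × Y z ≡ true)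
  overlap-nonempty X Y Z X⊆Z Y⊆Z large =
    let z , XYz = count-witness (X ∩ Y) elements overlap-positive in z , ∧-true⁻ (X z) XYz
    where
    open ≤-Reasoning
    overlap-positive : 0 < ∣ X ∩ Y ∣
    overlap-positive = +-cancelˡ-< (∣ Z ∣) 0 (∣ X ∩ Y ∣) (begin-strict
      ∣ Z ∣ + 0            ≡⟨ +-identityʳ (∣ Z ∣) ⟩
      ∣ Z ∣                <⟨ large ⟩
      ∣ X ∣ + ∣ Y ∣        ≤⟨ card-overlap X Y Z X⊆Z Y⊆Z ⟩
      ∣ X ∩ Y ∣ + ∣ Z ∣    ≡⟨ +-comm (∣ X ∩ Y ∣) (∣ Z ∣) ⟩
      ∣ Z ∣ + ∣ X ∩ Y ∣    ∎)

  ∈-sumset⁺ : ∀ X Y x y → X x ≡ true → Y y ≡ true → sumset G X Y (x ∙ y) ≡ true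
  ∈-sumset⁺ X Y x y Xx Yy =
    any-true⁺ _ elements (complete x)
      (any-true⁺ _ elements (complete y) (∧-true Xx (∧-true Yy (Equivalence.to T-≡ (fromWitness refl)))))

  ∈-sumset⁻ : ∀ X Y z → sumset G X Y z ≡ true →
    Σ Carrier λ x → Σ Carrier λ y → X x ≡ true × Y y ≡ true × z ≡ x ∙ y
  ∈-sumset⁻ X Y z z∈XY =
    let x , ∃y           = any-true⁻ _ elements z∈XY
        y , Xx∧Yy∧z≡xy   = any-true⁻ _ elements ∃y
        Xx , Yy∧z≡xy     = ∧-true⁻ (X x) Xx∧Yy∧z≡xy
        Yy , z≡xy        = ∧-true⁻ (Y y) Yy∧z≡xy
    in x , y , Xx , Yy , toWitness (Equivalence.from T-≡ z≡xy)

  translate-⊆-sumsetˡ : ∀ X Y y → Y y ≡ true → (X +ₛ y) ⊆ sumset G X Y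
  translate-⊆-sumsetˡ X Y y Yy z X[z//y] =
    subst (λ t → sumset G X Y t ≡ true) (//-rightDividesˡ y z) (∈-sumset⁺ X Y (z // y) y X[z//y] Yy)

  translate-⊆-sumsetʳ : ∀ X Y x → X x ≡ true → (Y +ₛ x) ⊆ sumset G X Y
  translate-⊆-sumsetʳ X Y x Xx z Y[z//x] =
    subst (λ t → sumset G X Y t ≡ true) (add-sub-cancel x z) (∈-sumset⁺ X Y x (z // x) Xx Y[z//x])

  ∈-differences⁺ : ∀ X x y → X x ≡ true → X y ≡ true → differences X (x // y) ≡ true
  ∈-differences⁺ X x y Xx Xy =
    ∈-sumset⁺ X (λ t → X (t ⁻¹)) x (y ⁻¹) Xx (subst (λ t → X t ≡ true) (sym (⁻¹-involutive y)) Xy)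

  ∈-differences⁻ : ∀ X h → differences X h ≡ true →
    Σ Carrier λ x → Σ Carrier λ y → X x ≡ true × X y ≡ true × h ≡ x // y
  ∈-differences⁻ X h h∈X-X =
    let x , y , Xx , X[y⁻¹] , h≡xy = ∈-sumset⁻ X (λ t → X (t ⁻¹)) h h∈X-X
    in x , y ⁻¹ , Xx , X[y⁻¹] , trans h≡xy (cong (x ∙_) (sym (⁻¹-involutive y)))

-- Arithmetic consequences of 2s < 3a < 4b

module Arithmetic where
  open ≤-Reasoning

  -- 2s < 3a < 4b: the sumset is smaller than two translates of B.
  sumset-below-twice : ∀ s a b → 2 * s < 3 * a → 3 * a < 4 * b → s < b + b
  sumset-below-twice s a b 2s<3a 3a<4b = *-cancelˡ-< 4 s (b + b) (begin-strict
    4 * s        ≡⟨ *-assoc 2 2 s ⟩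
    2 * (2 * s)  <⟨ *-monoʳ-< 2 2s<3a ⟩
    2 * (3 * a)  <⟨ *-monoʳ-< 2 3a<4b ⟩
    2 * (4 * b)  ≡⟨ lemma b ⟩
    4 * (b + b)  ∎)
    where
    lemma : ∀ b → 2 * (4 * b) ≡ 4 * (b + b)
    lemma = solve-∀

  -- Two subsets of A, each of size at least 2a - s, have more than a elements in total.
  two-overlaps-exceed : ∀ a s x y → a + a ≤ x + s → a + a ≤ y + s → 2 * s < 3 * a → a < x + y
  two-overlaps-exceed a s x y 2a≤x+s 2a≤y+s 2s<3a = +-cancelʳ-< (2 * s) a (x + y) (begin-strict
    a + 2 * s            <⟨ +-monoʳ-< a 2s<3a ⟩
    a + 3 * a            ≡⟨ lemma₁ a ⟩
    (a + a) + (a + a)    ≤⟨ +-mono-≤ 2a≤x+s 2a≤y+s ⟩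
    (x + s) + (y + s)    ≡⟨ lemma₂ x y s ⟩
    x + y + 2 * s        ∎)
    where
    lemma₁ : ∀ a → a + 3 * a ≡ (a + a) + (a + a)
    lemma₁ = solve-∀
    lemma₂ : ∀ x y s → (x + s) + (y + s) ≡ x + y + 2 * s
    lemma₂ = solve-∀

  -- A subset of A with more than s - a elements meets every subset of A with at least 2a - s.
  popular-overlap : ∀ a s r q → s < r + a → a + a ≤ q + s → a < r + q
  popular-overlap a s r q s<r+a 2a≤q+s = +-cancelʳ-< (a + s) a (r + q) (begin-strict
    a + (a + s)          ≡⟨ lemma₁ a s ⟩
    s + (a + a)          <⟨ +-mono-<-≤ s<r+a 2a≤q+s ⟩
    (r + a) + (q + s)    ≡⟨ lemma₂ r a q s ⟩
    (r + q) + (a + s)    ∎)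
    where
    lemma₁ : ∀ a s → a + (a + s) ≡ s + (a + a)
    lemma₁ = solve-∀
    lemma₂ : ∀ r a q s → (r + a) + (q + s) ≡ (r + q) + (a + s)
    lemma₂ = solve-∀

  excess-below-half : ∀ s a → 0 < a → 2 * s < 3 * a → 2 * (s ∸ a) < a
  excess-below-half s a 0<a 2s<3a with s ≤? a
  ... | yes s≤a rewrite m≤n⇒m∸n≡0 s≤a = 0<a
  ... | no  s≰a = +-cancelʳ-< (2 * a) (2 * (s ∸ a)) a (begin-strict
    2 * (s ∸ a) + 2 * a  ≡⟨ *-distribˡ-+ 2 (s ∸ a) a ⟨
    2 * (s ∸ a + a)      ≡⟨ cong (2 *_) (m∸n+n≡m (<⇒≤ (≰⇒> s≰a))) ⟩
    2 * s                <⟨ 2s<3a ⟩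
    3 * a                ≡⟨ lemma a ⟩
    a + 2 * a            ∎)
    where
    lemma : ∀ a → 3 * a ≡ a + 2 * a
    lemma = solve-∀

  -- The average number of representations ab/s exceeds s - a.
  average-exceeds : ∀ s a b → 0 < a → 2 * s < 3 * a → 3 * a < 4 * b → s * (s ∸ a) < a * b
  average-exceeds s a b 0<a 2s<3a 3a<4b = *-cancelˡ-< 4 (s * (s ∸ a)) (a * b) (begin-strict
    4 * (s * (s ∸ a))         ≡⟨ lemma₁ s (s ∸ a) ⟩
    (2 * s) * (2 * (s ∸ a))   <⟨ *-mono-< 2s<3a (excess-below-half s a 0<a 2s<3a) ⟩
    (3 * a) * a               <⟨ *-monoˡ-< a {{>-nonZero 0<a}} 3a<4b ⟩
    (4 * b) * a               ≡⟨ lemma₂ a b ⟩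
    4 * (a * b)               ∎)
    where
    lemma₁ : ∀ s m → 4 * (s * m) ≡ (2 * s) * (2 * m)
    lemma₁ = solve-∀
    lemma₂ : ∀ a b → (4 * b) * a ≡ 4 * (a * b)
    lemma₂ = solve-∀

  positive-of-bound : ∀ a b → 3 * a < 4 * b → 0 < b
  positive-of-bound a (suc b) _ = z<s
  positive-of-bound a zero 3a<0 = contradiction (subst (3 * a <_) (*-zeroʳ 4) 3a<0) n≮0

-- The argument, under the hypotheses of the theorem

module Proof (G : FiniteAbelianGroup) (A B : Subset G)
    (b₀ : FiniteAbelianGroup.Carrier G) (b₀∈B : B b₀ ≡ true)
    (B≤A : card G A ≥ card G B)
    (small-sumset : 2 * card G (sumset G A B) < 3 * card G A)
    (large-B : 3 * card G A < 4 * card G B) where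

  open FiniteAbelianGroup G using (Carrier; elements)
  open FiniteGroup G
  open Arithmetic

  S H : Subset G
  S = sumset G A B
  H = differences B

  a b s : ℕ
  a = ∣ A ∣
  b = ∣ B ∣
  s = ∣ S ∣

  -- Step 1: A - A ⊆ H, because the translates B + x, B + y (x, y ∈ A) meet inside S.
  A-A⊆H : ∀ x y → A x ≡ true → A y ≡ true → H (x // y) ≡ true
  A-A⊆H x y Ax Ay =
    let z , B[z//x] , B[z//y] = overlap-nonempty (B +ₛ x) (B +ₛ y) S
          (translate-⊆-sumsetʳ A B x Ax) (translate-⊆-sumsetʳ A B y Ay) translates-too-large
    in subst (λ t → H t ≡ true) (sub-of-subs z x y) (∈-differences⁺ B (z // y) (z // x) B[z//y] B[z//x])
    where
    translates-too-large : s < ∣ B +ₛ x ∣ + ∣ B +ₛ y ∣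
    translates-too-large = subst₂ (λ p q → s < p + q) (sym (card-translate B x)) (sym (card-translate B y))
      (sumset-below-twice s a b small-sumset large-B)

  Q : Carrier → Subset G
  Q h w = A w ∧ A (w ∙ h)

  Q⊆A : ∀ h → Q h ⊆ A
  Q⊆A h w Qhw = proj₁ (∧-true⁻ (A w) Qhw)

  translates-overlap : ∀ y₁ y₂ → ∣ (A +ₛ y₁) ∩ (A +ₛ y₂) ∣ ≡ ∣ Q (y₁ // y₂) ∣
  translates-overlap y₁ y₂ = trans (count-cong _ _ elements pointwise) (card-translate (Q (y₁ // y₂)) y₁)
    where
    pointwise : ∀ z → A (z // y₁) ∧ A (z // y₂) ≡ Q (y₁ // y₂) (z // y₁)
    pointwise z = cong (λ t → A (z // y₁) ∧ A t) (sym (sub-add-sub z y₁ y₂))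

  overlap-bound-for : ∀ y₁ y₂ → B y₁ ≡ true → B y₂ ≡ true → a + a ≤ ∣ Q (y₁ // y₂) ∣ + s
  overlap-bound-for y₁ y₂ By₁ By₂ = begin
    a + a                            ≡⟨ cong₂ _+_ (card-translate A y₁) (card-translate A y₂) ⟨
    ∣ A +ₛ y₁ ∣ + ∣ A +ₛ y₂ ∣          ≤⟨ card-overlap (A +ₛ y₁) (A +ₛ y₂) S
                                           (translate-⊆-sumsetˡ A B y₁ By₁) (translate-⊆-sumsetˡ A B y₂ By₂) ⟩
    ∣ (A +ₛ y₁) ∩ (A +ₛ y₂) ∣ + s      ≡⟨ cong (_+ s) (translates-overlap y₁ y₂) ⟩
    ∣ Q (y₁ // y₂) ∣ + s               ∎
    where open ≤-Reasoning

  overlap-bound : ∀ h → H h ≡ true → a + a ≤ ∣ Q h ∣ + s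
  overlap-bound h h∈H =
    let y₁ , y₂ , By₁ , By₂ , h≡y₁//y₂ = ∈-differences⁻ B h h∈H
    in subst (λ t → a + a ≤ ∣ Q t ∣ + s) (sym h≡y₁//y₂) (overlap-bound-for y₁ y₂ By₁ By₂)

  ε∈H : H ε ≡ true
  ε∈H = subst (λ t → H t ≡ true) (inverseʳ b₀) (∈-differences⁺ B b₀ b₀ b₀∈B b₀∈B)

  ⁻¹∈H : ∀ h → H h ≡ true → H (h ⁻¹) ≡ true
  ⁻¹∈H h h∈H =
    let y₁ , y₂ , By₁ , By₂ , h≡y₁//y₂ = ∈-differences⁻ B h h∈H
    in subst (λ t → H t ≡ true) (sym (trans (cong _⁻¹ h≡y₁//y₂) (⁻¹-anti-homo-// y₁ y₂)))
         (∈-differences⁺ B y₂ y₁ By₂ By₁)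

  -- Q h and Q k⁻¹ share an element w, and h ∙ k = (w ∙ h) - (w ∙ k⁻¹) ∈ A - A.
  ∙∈H : ∀ h k → H h ≡ true → H k ≡ true → H (h ∙ k) ≡ true
  ∙∈H h k h∈H k∈H =
    let w , Qhw , Qk⁻¹w = overlap-nonempty (Q h) (Q (k ⁻¹)) A (Q⊆A h) (Q⊆A (k ⁻¹))
          (two-overlaps-exceed a s (∣ Q h ∣) (∣ Q (k ⁻¹) ∣)
            (overlap-bound h h∈H) (overlap-bound (k ⁻¹) (⁻¹∈H k k∈H)) small-sumset)
    in subst (λ t → H t ≡ true) (product-as-difference w h k)
         (A-A⊆H (w ∙ h) (w ∙ k ⁻¹) (proj₂ (∧-true⁻ (A w) Qhw)) (proj₂ (∧-true⁻ (A w) Qk⁻¹w)))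

  H-subgroup : IsSubgroup G H
  H-subgroup = record { ε∈H = ε∈H ; ∙∈H = ∙∈H ; ⁻¹∈H = ⁻¹∈H }

  -- Step 4: r c = |A ∩ (c - B)| counts the representations c = u ∙ (c // u).
  R : Carrier → Subset G
  R c u = A u ∧ B (c // u)

  r : Carrier → ℕ
  r c = ∣ R c ∣

  r-supported : ∀ c → S c ≡ false → r c ≡ 0
  r-supported c c∉S = n≤0⇒n≡0 (subst (r c ≤_) (count-false elements)
    (count-mono (R c) (λ _ → false) elements (λ u Rcu → trans (sym c∉S) (R⊆S u Rcu))))
    where
    R⊆S : ∀ u → R c u ≡ true → S c ≡ true
    R⊆S u Rcu = let Au , B[c//u] = ∧-true⁻ (A u) Rcu in translate-⊆-sumsetʳ A B u Au c B[c//u]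

  representations-via : ∀ u → count (λ c → R c u) elements ≡ indicator (A u) * b
  representations-via u with A u
  ... | true  = trans (card-translate B u) (sym (+-identityʳ b))
  ... | false = count-false elements

  r-total : sum (map r elements) ≡ a * b
  r-total = begin
    sum (map r elements)                                   ≡⟨ double-count R elements elements ⟩
    sum (map (λ u → count (λ c → R c u) elements) elements) ≡⟨ cong sum (map-cong representations-via elements) ⟩
    sum (map (λ u → indicator (A u) * b) elements)          ≡⟨ sum-*ʳ (λ u → indicator (A u)) b elements ⟩
    sum (map (λ u → indicator (A u)) elements) * b          ≡⟨ cong (_* b) (count≡sum A elements) ⟨
    a * b                                                  ∎
    where open ≡-Reasoning

  -- Averaging over S: some c has more than s - a representations.
  popular-sum : Σ Carrier λ c → s < r c + a
  popular-sum =
    let c , s∸a<rc = above-average r S (s ∸ a) elements r-supported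
          (subst (s * (s ∸ a) <_) (sym r-total)
            (average-exceeds s a b (<-≤-trans (positive-of-bound a b large-B) B≤A) small-sumset large-B))
    in c , popular c s∸a<rc
    where
    open ≤-Reasoning
    popular : ∀ c → s ∸ a < r c → s < r c + a
    popular c s∸a<rc = begin-strict
      s            ≤⟨ m≤n+m∸n s a ⟩
      a + (s ∸ a)  <⟨ +-monoʳ-< a s∸a<rc ⟩
      a + r c      ≡⟨ +-comm a (r c) ⟩
      r c + a      ∎

  -- Step 5: for a popular c, R c and Q h meet inside A, so c + H ⊆ S and |H| ≤ s.
  coset⊆S : ∀ c → s < r c + a → ∀ h → H h ≡ true → S (c ∙ h) ≡ true
  coset⊆S c popular h h∈H =
    let u , Rcu , Qhu = overlap-nonempty (R c) (Q h) A (λ u Rcu → proj₁ (∧-true⁻ (A u) Rcu)) (Q⊆A h)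
          (popular-overlap a s (r c) (∣ Q h ∣) popular (overlap-bound h h∈H))
    in subst (λ t → S t ≡ true) (translate-split c u h)
         (∈-sumset⁺ A B (u ∙ h) (c // u) (proj₂ (∧-true⁻ (A u) Qhu)) (proj₂ (∧-true⁻ (A u) Rcu)))

  popular∈S : ∀ c → s < r c + a → S c ≡ true
  popular∈S c popular = subst (λ t → S t ≡ true) (identityʳ c) (coset⊆S c popular ε ε∈H)

  H-small : ∀ c → s < r c + a → ∣ H ∣ ≤ s
  H-small c popular = subst (_≤ s) (card-translate H c) (count-mono (H +ₛ c) S elements
    (λ z H[z//c] → subst (λ t → S t ≡ true) (add-sub-cancel c z) (coset⊆S c popular (z // c) H[z//c])))

  -- Step 6: S - S ⊆ (A - A) ∙ (B - B) ⊆ H, so S lies in the coset of H through any c ∈ S.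
  S-S⊆H : ∀ z c → S z ≡ true → S c ≡ true → H (z // c) ≡ true
  S-S⊆H z c z∈S c∈S =
    let x₁ , y₁ , Ax₁ , By₁ , z≡x₁y₁ = ∈-sumset⁻ A B z z∈S
        x₂ , y₂ , Ax₂ , By₂ , c≡x₂y₂ = ∈-sumset⁻ A B c c∈S
        z//c≡ : z // c ≡ (x₁ // x₂) ∙ (y₁ // y₂)
        z//c≡ = trans (cong₂ _//_ z≡x₁y₁ c≡x₂y₂) (sub-interchange x₁ y₁ x₂ y₂)
    in subst (λ t → H t ≡ true) (sym z//c≡)
         (∙∈H (x₁ // x₂) (y₁ // y₂) (A-A⊆H x₁ x₂ Ax₁ Ax₂) (∈-differences⁺ B y₁ y₂ By₁ By₂))

  S-in-coset : ∀ c → S c ≡ true → InSingleCoset G S H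
  S-in-coset c c∈S = c , λ z z∈S → z // c , S-S⊆H z c z∈S c∈S , sym (add-sub-cancel c z)

proposition1 : (G : FiniteAbelianGroup) → (A B : Subset G) →
    Nonempty G A → Nonempty G B →
    card G A ≥ card G B →
    2 * card G (sumset G A B) < 3 * card G A →
    3 * card G A < 4 * card G B →
    Σ (Subset G) (λ H → IsSubgroup G H × (2 * card G H < 3 * card G A) × InSingleCoset G (sumset G A B) H)
proposition1 G A B _ (b₀ , b₀∈B) B≤A small-sumset large-B =
  H , H-subgroup , ≤-<-trans (*-monoʳ-≤ 2 (H-small c c-popular)) small-sumset ,
  S-in-coset c (popular∈S c c-popular)
  where
  open Proof G A B b₀ b₀∈B B≤A small-sumset large-B
  c : FiniteAbelianGroup.Carrier G
  c = proj₁ popular-sum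
  c-popular : s < r c + a
  c-popular = proj₂ popular-sum
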